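{- Let $n\ge 3$ be an integer and $s\in\{0,2,3,4\}$. Then the arc set of $\overrightarrow{C}_{(4:n)}$ can be partitioned into $s$ $\overrightarrow{C}_{2n}$-factors and $4-s$ $\overrightarrow{C}_n$-factors.
   Context: For positive integers $x$ and $k\ge 3$, $\overrightarrow{C}_{(x:k)}$ is the directed graph with vertex set $\{(g,i):0\le g\le x-1,\ i\in\mathbb{Z}_k\}$ and arcs $((g,i),(h,i+1))$ for all $g,h$ and $i\in\mathbb{Z}_k$. A $\overrightarrow{C}_\ell$-factor is a spanning subgraph each of whose components is a directed cycle of length $\ell$. -}

module Defs where

open import Data.Nat using (ℕ; zero; suc; _<_; _*_)
open import Data.Nat.DivMod using (_mod_)
open import Data.Fin using (Fin; toℕ)
open import Data.Product using (Σ; ∃; _×_; _,_; proj₁; proj₂)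
open import Relation.Binary.PropositionalEquality using (_≡_; _≢_)

sucMod : ∀ {k} → Fin k → Fin k
sucMod {suc m} i = suc (toℕ i) mod suc m

iter : ∀ {V : Set} → (V → V) → ℕ → V → V
iter f zero v = v
iter f (suc j) v = f (iter f j v)

-- The digraph C→_(x:k): vertices (g , i) with g ∈ {0..x-1}, i ∈ ℤ_k,
-- arcs ((g,i),(h,i+1)) for all g, h, i.
Vtx : ℕ → ℕ → Set
Vtx x k = Fin x × Fin k

Arc : (x k : ℕ) → Vtx x k → Vtx x k → Set
Arc x k u v = proj₂ v ≡ sucMod (proj₂ u)

-- A spanning subgraph F (given by its arc relation) of a digraph on V is a
-- directed ℓ-cycle factor: every vertex has exactly one out-arc and exactly
-- one in-arc in F (so the components are directed cycles, traced by the
-- successor map), and every vertex lies on a directed cycle of length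
-- exactly ℓ.
record CycleFactor (V : Set) (F : V → V → Set) (ℓ : ℕ) : Set where
  field
    next       : V → V
    next-arc   : ∀ v → F v (next v)
    out-unique : ∀ v w → F v w → w ≡ next v
    in-exists  : ∀ w → ∃ λ v → F v w
    in-unique  : ∀ v v' w → F v w → F v' w → v ≡ v'
    cycle      : ∀ v → iter next ℓ v ≡ v
    cycle-min  : ∀ v j → 0 < j → j < ℓ → iter next j v ≢ v

ColourClass : (x k m : ℕ) → ((u v : Vtx x k) → Arc x k u v → Fin m) →
              Fin m → Vtx x k → Vtx x k → Set
ColourClass x k m col c u v = Σ (Arc x k u v) λ a → col u v a ≡ c

-- Identify the four rows of C→_(4:n) with the Klein group ℤ₂² and give the arc
-- (g , i) → (h , i + 1) the colour D_i⁻¹ (g ⊕ h), for bijections D_i from the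
-- colours to ℤ₂².  Colour class c then moves (g , i) to (g ⊕ D_i c , i + 1), so it
-- is the graph of a bijection, and one lap around the n levels translates every
-- row by the same shift D_0 c ⊕ ⋯ ⊕ D_{n-1} c.  As ℤ₂² has exponent 2, the class is
-- a C→_n-factor when the shift is 0 and a C→_{2n}-factor otherwise.  Taking D_0 = π
-- and letting the remaining levels sum to c makes the shift π c ⊕ c, which vanishes
-- exactly at the fixed points of π; so s must be the number of points moved by a
-- permutation of four points: any of 0, 2, 3, 4, but never 1.

module Submission where

open import Defs
open import Algebra.Bundles using (AbelianGroup)
open import Algebra.Core using (Op₁; Op₂)
open import Algebra.Definitions using (Associative; Commutative; LeftIdentity; RightIdentity)
open import Algebra.Structures using (IsMonoid; IsAbelianGroup)
open import Data.Bool using (Bool; true; false; _xor_)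
open import Data.Empty using (⊥-elim)
open import Data.Fin using (Fin; toℕ; zero; suc; _≟_)
open import Data.Fin.Patterns using (0F; 1F; 2F; 3F)
open import Data.Fin.Permutation using (Permutation′; _⟨$⟩ʳ_; _⟨$⟩ˡ_; id; _∘ₚ_; transpose; inverseˡ)
open import Data.Fin.Properties using (toℕ-fromℕ<; toℕ-injective; toℕ<n; all?)
open import Data.Nat using (ℕ; NonZero; zero; suc; _+_; _*_; _≤_; _<_; _%_; _/_; z≤n; s≤s; _<?_; _≤?_; parity)
open import Data.Nat.DivMod using (m≡m%n+[m/n]*n; m%n%n≡m%n; [m+n]%n≡m%n; m<n⇒m%n≡m; %-distribˡ-+)
open import Data.Nat.Divisibility using (_∣_; divides; divides-refl; >⇒∤)
open import Data.Nat.Properties using (≤-refl; <⇒≤; +-suc; +-identityʳ; +-cancelˡ-≡; +-monoʳ-≤; <⇒≱)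
open import Data.Parity using (Parity; 0ℙ; 1ℙ)
open import Data.Product using (Σ; ∃; _×_; _,_; proj₁; proj₂)
open import Data.Sum using (_⊎_; inj₁; inj₂)
open import Function.Bundles using (Inverse)
open import Relation.Nullary.Decidable using (Dec; from-yes; ¬?; _×-dec_; _→-dec_)
open import Relation.Binary.PropositionalEquality
  using (_≡_; _≢_; refl; sym; trans; cong; cong₂; subst; module ≡-Reasoning)
open import Relation.Binary.PropositionalEquality.Properties using (isEquivalence)

open ≡-Reasoning

iter-+ : ∀ {V : Set} (f : V → V) a b v → iter f (a + b) v ≡ iter f a (iter f b v)
iter-+ f zero    b v = refl
iter-+ f (suc a) b v = cong f (iter-+ f a b v)

iter-suc-inner : ∀ {V : Set} (f : V → V) j v → iter f j (f v) ≡ iter f (suc j) v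
iter-suc-inner f zero    v = refl
iter-suc-inner f (suc j) v = cong f (iter-suc-inner f j v)

[1+m%n]%n≡[1+m]%n : ∀ m n .{{_ : NonZero n}} → suc (m % n) % n ≡ suc m % n
[1+m%n]%n≡[1+m]%n m n = begin
  (1 + m % n) % n           ≡⟨ %-distribˡ-+ 1 (m % n) n ⟩
  (1 % n + m % n % n) % n   ≡⟨ cong (λ t → (1 % n + t) % n) (m%n%n≡m%n m n) ⟩
  (1 % n + m % n) % n       ≡⟨ %-distribˡ-+ 1 m n ⟨
  (1 + m) % n               ∎

module _ {m : ℕ} where

  toℕ-iter-sucMod : ∀ j (i : Fin (suc m)) → toℕ (iter sucMod j i) ≡ (toℕ i + j) % suc m
  toℕ-iter-sucMod zero i = sym (trans (cong (_% suc m) (+-identityʳ (toℕ i))) (m<n⇒m%n≡m (toℕ<n i)))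
  toℕ-iter-sucMod (suc j) i = begin
    toℕ (sucMod (iter sucMod j i))        ≡⟨ toℕ-fromℕ< _ ⟩
    suc (toℕ (iter sucMod j i)) % suc m  ≡⟨ cong (λ t → suc t % suc m) (toℕ-iter-sucMod j i) ⟩
    suc ((toℕ i + j) % suc m) % suc m    ≡⟨ [1+m%n]%n≡[1+m]%n (toℕ i + j) (suc m) ⟩
    suc (toℕ i + j) % suc m              ≡⟨ cong (_% suc m) (+-suc (toℕ i) j) ⟨
    (toℕ i + suc j) % suc m              ∎

  iter-sucMod-period : ∀ (i : Fin (suc m)) → iter sucMod (suc m) i ≡ i
  iter-sucMod-period i = toℕ-injective (begin
    toℕ (iter sucMod (suc m) i)  ≡⟨ toℕ-iter-sucMod (suc m) i ⟩
    (toℕ i + suc m) % suc m      ≡⟨ [m+n]%n≡m%n (toℕ i) (suc m) ⟩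
    toℕ i % suc m                ≡⟨ m<n⇒m%n≡m (toℕ<n i) ⟩
    toℕ i                        ∎)

  iter-sucMod-fixed⇒∣ : ∀ j (i : Fin (suc m)) → iter sucMod j i ≡ i → suc m ∣ j
  iter-sucMod-fixed⇒∣ j i fixed = divides q (+-cancelˡ-≡ (toℕ i) j (q * suc m) (begin
    toℕ i + j                             ≡⟨ m≡m%n+[m/n]*n (toℕ i + j) (suc m) ⟩
    (toℕ i + j) % suc m + q * suc m       ≡⟨ cong (_+ q * suc m) (toℕ-iter-sucMod j i) ⟨
    toℕ (iter sucMod j i) + q * suc m     ≡⟨ cong (λ v → toℕ v + q * suc m) fixed ⟩
    toℕ i + q * suc m                     ∎))
    where
    q : ℕ
    q = (toℕ i + j) / suc m

  iter-sucMod-zero : ∀ (i : Fin (suc m)) → iter sucMod (toℕ i) zero ≡ i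
  iter-sucMod-zero i = toℕ-injective (trans (toℕ-iter-sucMod (toℕ i) zero) (m<n⇒m%n≡m (toℕ<n i)))

  toℕ-iter-sucMod-zero : ∀ {j} → j < suc m → toℕ (iter sucMod j (zero {m})) ≡ j
  toℕ-iter-sucMod-zero {j} j<1+m = trans (toℕ-iter-sucMod j zero) (m<n⇒m%n≡m j<1+m)

m∣n∧0<n<2m⇒n≡m : ∀ {m n} → m ∣ n → 0 < n → n < 2 * m → n ≡ m
m∣n∧0<n<2m⇒n≡m     (divides-refl 0)             ()
m∣n∧0<n<2m⇒n≡m {m} (divides-refl 1)             _ _    = +-identityʳ m
m∣n∧0<n<2m⇒n≡m {m} (divides-refl (suc (suc q))) _ n<2m =
  ⊥-elim (<⇒≱ n<2m (+-monoʳ-≤ m (+-monoʳ-≤ m z≤n)))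

module _ {V : Set} {F : V → V → Set} {ℓ : ℕ} (f : V → V)
         (f-arc : ∀ v → F v (f v)) (arc⇒f : ∀ v w → F v w → w ≡ f v)
         (f-period : ∀ v → iter f (suc ℓ) v ≡ v)
         (f-minimal : ∀ v j → 0 < j → j < suc ℓ → iter f j v ≢ v) where

  -- Having period suc ℓ, f is a bijection with inverse iter f ℓ.
  successor-cycleFactor : CycleFactor V F (suc ℓ)
  successor-cycleFactor = record
    { next       = f
    ; next-arc   = f-arc
    ; out-unique = arc⇒f
    ; in-exists  = λ w → iter f ℓ w , subst (F (iter f ℓ w)) (f-period w) (f-arc (iter f ℓ w))
    ; in-unique  = λ v v' w Fvw Fv'w → f-injective (trans (sym (arc⇒f v w Fvw)) (arc⇒f v' w Fv'w))
    ; cycle      = f-period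
    ; cycle-min  = f-minimal
    }
    where
    f-injective : ∀ {v v'} → f v ≡ f v' → v ≡ v'
    f-injective {v} {v'} e = begin
      v                  ≡⟨ f-period v ⟨
      iter f (suc ℓ) v   ≡⟨ iter-suc-inner f ℓ v ⟨
      iter f ℓ (f v)     ≡⟨ cong (iter f ℓ) e ⟩
      iter f ℓ (f v')    ≡⟨ iter-suc-inner f ℓ v' ⟩
      iter f (suc ℓ) v'  ≡⟨ f-period v' ⟩
      v'                 ∎

module _ {A : Set} (_∙_ : Op₂ A) (ε : A) where

  product : ℕ → (ℕ → A) → A
  product zero    f = ε
  product (suc n) f = product n f ∙ f n

module _ {A : Set} {_∙_ : Op₂ A} {ε : A} (isMonoid : IsMonoid _≡_ _∙_ ε) where

  open IsMonoid isMonoid using (assoc; identityʳ)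

  product-+ : ∀ a b f → product _∙_ ε (a + b) f ≡ product _∙_ ε a f ∙ product _∙_ ε b (λ l → f (a + l))
  product-+ a zero    f = trans (cong (λ n → product _∙_ ε n f) (+-identityʳ a)) (sym (identityʳ _))
  product-+ a (suc b) f = begin
    product _∙_ ε (a + suc b) f
      ≡⟨ cong (λ n → product _∙_ ε n f) (+-suc a b) ⟩
    product _∙_ ε (a + b) f ∙ f (a + b)
      ≡⟨ cong (_∙ f (a + b)) (product-+ a b f) ⟩
    (product _∙_ ε a f ∙ product _∙_ ε b (λ l → f (a + l))) ∙ f (a + b)
      ≡⟨ assoc _ _ _ ⟩
    product _∙_ ε a f ∙ product _∙_ ε (suc b) (λ l → f (a + l))
      ∎

-- D l maps each colour to its difference at level l: the arc (g , i) → (h , i + 1)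
-- gets the colour whose difference at level i is g⁻¹ ∙ h. Levels are read through
-- toℕ, so only D 0, …, D m matter.
module DifferenceColouring
  {x : ℕ} {_∙_ : Op₂ (Fin x)} {ε : Fin x} {_⁻¹ : Op₁ (Fin x)}
  (isAbelianGroup : IsAbelianGroup _≡_ _∙_ ε _⁻¹) (m : ℕ) (D : ℕ → Permutation′ x) where

  private
    k : ℕ
    k = suc m

    abelianGroup : AbelianGroup _ _
    abelianGroup = record { isAbelianGroup = isAbelianGroup }

  open IsAbelianGroup isAbelianGroup using (assoc; comm; identityˡ; identityʳ)
  open import Algebra.Properties.AbelianGroup abelianGroup
    using (\\-leftDividesˡ; \\-leftDividesʳ; ∙-cancelˡ; identityʳ-unique)

  colouring : (u v : Vtx x k) → Arc x k u v → Fin x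
  colouring (g , i) (h , _) _ = D (toℕ i) ⟨$⟩ˡ ((g ⁻¹) ∙ h)

  shift : Fin x → Fin x
  shift c = product _∙_ ε k (λ l → D l ⟨$⟩ʳ c)

  module _ (c : Fin x) where

    difference : Fin k → Fin x
    difference i = D (toℕ i) ⟨$⟩ʳ c

    step : Vtx x k → Vtx x k
    step (g , i) = g ∙ difference i , sucMod i

    walkShift : Fin k → ℕ → Fin x
    walkShift i zero    = ε
    walkShift i (suc j) = walkShift i j ∙ difference (iter sucMod j i)

    step-colour : ∀ v → ColourClass x k x colouring c v (step v)
    step-colour (g , i) = refl , (begin
      D (toℕ i) ⟨$⟩ˡ ((g ⁻¹) ∙ (g ∙ difference i))
        ≡⟨ cong (D (toℕ i) ⟨$⟩ˡ_) (\\-leftDividesʳ g (difference i)) ⟩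
      D (toℕ i) ⟨$⟩ˡ difference i
        ≡⟨ inverseˡ (D (toℕ i)) ⟩
      c ∎)

    colour⇒step : ∀ v w → ColourClass x k x colouring c v w → w ≡ step v
    colour⇒step (g , i) (h , j) (j≡1+i , colour≡c) = cong₂ _,_ (begin
      h                 ≡⟨ \\-leftDividesˡ g h ⟨
      g ∙ ((g ⁻¹) ∙ h)  ≡⟨ cong (g ∙_) (sym (Inverse.inverseˡ (D (toℕ i)) (sym colour≡c))) ⟩
      g ∙ difference i  ∎) j≡1+i

    iter-step : ∀ j g i → iter step j (g , i) ≡ (g ∙ walkShift i j , iter sucMod j i)
    iter-step zero    g i = cong (_, i) (sym (identityʳ g))
    iter-step (suc j) g i = trans (cong step (iter-step j g i))
      (cong (_, iter sucMod (suc j) i) (assoc g (walkShift i j) (difference (iter sucMod j i))))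

    walkShift-suc : ∀ j i → walkShift i (suc j) ≡ difference i ∙ walkShift (sucMod i) j
    walkShift-suc zero    i = trans (identityˡ (difference i)) (sym (identityʳ (difference i)))
    walkShift-suc (suc j) i = begin
      walkShift i (suc j) ∙ difference (iter sucMod (suc j) i)
        ≡⟨ cong₂ _∙_ (walkShift-suc j i) (cong difference (sym (iter-suc-inner sucMod j i))) ⟩
      (difference i ∙ walkShift (sucMod i) j) ∙ difference (iter sucMod j (sucMod i))
        ≡⟨ assoc (difference i) _ _ ⟩
      difference i ∙ walkShift (sucMod i) (suc j)
        ∎

    walkShift-sucMod : ∀ i → walkShift (sucMod i) k ≡ walkShift i k
    walkShift-sucMod i = ∙-cancelˡ (difference i) _ _ (begin
      difference i ∙ walkShift (sucMod i) k   ≡⟨ walkShift-suc k i ⟨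
      walkShift i k ∙ difference (iter sucMod k i)
                                              ≡⟨ cong (λ i′ → walkShift i k ∙ difference i′) (iter-sucMod-period i) ⟩
      walkShift i k ∙ difference i            ≡⟨ comm (walkShift i k) (difference i) ⟩
      difference i ∙ walkShift i k            ∎)

    walkShift-iter : ∀ t i → walkShift (iter sucMod t i) k ≡ walkShift i k
    walkShift-iter zero    i = refl
    walkShift-iter (suc t) i = trans (walkShift-sucMod (iter sucMod t i)) (walkShift-iter t i)

    walkShift-zero : ∀ j → j ≤ k → walkShift zero j ≡ product _∙_ ε j (λ l → D l ⟨$⟩ʳ c)
    walkShift-zero zero    _     = refl
    walkShift-zero (suc j) j<k = cong₂ _∙_ (walkShift-zero j (<⇒≤ j<k))
      (cong (λ l → D l ⟨$⟩ʳ c) (toℕ-iter-sucMod-zero j<k))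

    walkShift-lap : ∀ i → walkShift i k ≡ shift c
    walkShift-lap i = begin
      walkShift i k                           ≡⟨ cong (λ i′ → walkShift i′ k) (iter-sucMod-zero i) ⟨
      walkShift (iter sucMod (toℕ i) zero) k  ≡⟨ walkShift-iter (toℕ i) zero ⟩
      walkShift zero k                        ≡⟨ walkShift-zero k ≤-refl ⟩
      shift c                                 ∎

    iter-step-lap : ∀ g i → iter step k (g , i) ≡ (g ∙ shift c , i)
    iter-step-lap g i = trans (iter-step k g i)
      (cong₂ _,_ (cong (g ∙_) (walkShift-lap i)) (iter-sucMod-period i))

    iter-step-fixed⇒∣ : ∀ j v → iter step j v ≡ v → k ∣ j
    iter-step-fixed⇒∣ j (g , i) fixed =
      iter-sucMod-fixed⇒∣ j i (trans (cong proj₂ (sym (iter-step j g i))) (cong proj₂ fixed))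

    lap-cycleFactor : shift c ≡ ε → CycleFactor (Vtx x k) (ColourClass x k x colouring c) k
    lap-cycleFactor shift≡ε = successor-cycleFactor step step-colour colour⇒step period minimal
      where
      period : ∀ v → iter step k v ≡ v
      period (g , i) = trans (iter-step-lap g i)
        (cong (_, i) (trans (cong (g ∙_) shift≡ε) (identityʳ g)))
      minimal : ∀ v j → 0 < j → j < k → iter step j v ≢ v
      minimal v (suc j) _ j<k fixed = >⇒∤ j<k (iter-step-fixed⇒∣ (suc j) v fixed)

    doubleLap-cycleFactor : shift c ≢ ε → shift c ∙ shift c ≡ ε →
                            CycleFactor (Vtx x k) (ColourClass x k x colouring c) (2 * k)
    doubleLap-cycleFactor shift≢ε shift²≡ε = successor-cycleFactor step step-colour colour⇒step period minimal
      where
      period : ∀ v → iter step (2 * k) v ≡ v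
      period (g , i) = begin
        iter step (k + (k + 0)) (g , i)       ≡⟨ cong (λ t → iter step (k + t) (g , i)) (+-identityʳ k) ⟩
        iter step (k + k) (g , i)             ≡⟨ iter-+ step k k (g , i) ⟩
        iter step k (iter step k (g , i))     ≡⟨ cong (iter step k) (iter-step-lap g i) ⟩
        iter step k (g ∙ shift c , i)         ≡⟨ iter-step-lap (g ∙ shift c) i ⟩
        ((g ∙ shift c) ∙ shift c , i)         ≡⟨ cong (_, i) (assoc g (shift c) (shift c)) ⟩
        (g ∙ (shift c ∙ shift c) , i)         ≡⟨ cong (λ h → g ∙ h , i) shift²≡ε ⟩
        (g ∙ ε , i)                           ≡⟨ cong (_, i) (identityʳ g) ⟩
        (g , i)                               ∎
      minimal : ∀ v j → 0 < j → j < 2 * k → iter step j v ≢ v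
      minimal (g , i) j 0<j j<2k fixed with m∣n∧0<n<2m⇒n≡m (iter-step-fixed⇒∣ j (g , i) fixed) 0<j j<2k
      ... | refl = shift≢ε (identityʳ-unique g (shift c) (cong proj₁ (trans (sym (iter-step-lap g i)) fixed)))

bits : Fin 4 → Bool × Bool
bits 0F = false , false
bits 1F = false , true
bits 2F = true  , false
bits 3F = true  , true

fromBits : Bool × Bool → Fin 4
fromBits (false , false) = 0F
fromBits (false , true)  = 1F
fromBits (true  , false) = 2F
fromBits (true  , true)  = 3F

infixl 6 _⊕_

_⊕_ : Op₂ (Fin 4)
a ⊕ b = fromBits (proj₁ (bits a) xor proj₁ (bits b) , proj₂ (bits a) xor proj₂ (bits b))

⊕-assoc : Associative _≡_ _⊕_
⊕-assoc = from-yes (all? λ a → all? λ b → all? λ c → (a ⊕ b) ⊕ c ≟ a ⊕ (b ⊕ c))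

⊕-comm : Commutative _≡_ _⊕_
⊕-comm = from-yes (all? λ a → all? λ b → a ⊕ b ≟ b ⊕ a)

⊕-identityˡ : LeftIdentity _≡_ 0F _⊕_
⊕-identityˡ = from-yes (all? λ a → 0F ⊕ a ≟ a)

⊕-identityʳ : RightIdentity _≡_ 0F _⊕_
⊕-identityʳ = from-yes (all? λ a → a ⊕ 0F ≟ a)

⊕-self : ∀ a → a ⊕ a ≡ 0F
⊕-self = from-yes (all? λ a → a ⊕ a ≟ 0F)

⊕≡0⇒≡ : ∀ a b → a ⊕ b ≡ 0F → a ≡ b
⊕≡0⇒≡ = from-yes (all? λ a → all? λ b → (a ⊕ b ≟ 0F) →-dec (a ≟ b))

⊕-isAbelianGroup : IsAbelianGroup _≡_ _⊕_ 0F (λ a → a)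
⊕-isAbelianGroup = record
  { isGroup = record
    { isMonoid = record
      { isSemigroup = record
        { isMagma = record { isEquivalence = isEquivalence ; ∙-cong = cong₂ _⊕_ }
        ; assoc   = ⊕-assoc
        }
      ; identity = ⊕-identityˡ , ⊕-identityʳ
      }
    ; inverse = ⊕-self , ⊕-self
    ; ⁻¹-cong = λ a≡b → a≡b
    }
  ; comm = ⊕-comm
  }

_·_ : Parity → Fin 4 → Fin 4
0ℙ · a = 0F
1ℙ · a = a

product-const : ∀ r a → product _⊕_ 0F r (λ _ → a) ≡ parity r · a
product-const zero          a = refl
product-const (suc zero)    a = ⊕-identityˡ a
product-const (suc (suc r)) a = begin
  (rᵃ ⊕ a) ⊕ a    ≡⟨ ⊕-assoc rᵃ a a ⟩
  rᵃ ⊕ (a ⊕ a)    ≡⟨ cong (rᵃ ⊕_) (⊕-self a) ⟩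
  rᵃ ⊕ 0F         ≡⟨ ⊕-identityʳ rᵃ ⟩
  rᵃ              ≡⟨ product-const r a ⟩
  parity r · a    ∎
  where
  rᵃ : Fin 4
  rᵃ = product _⊕_ 0F r (λ _ → a)

ω : Permutation′ 4
ω = transpose 1F 2F ∘ₚ transpose 2F 3F

-- Levels 1 and 2 compensate the parity of the r identity levels that follow them,
-- so that levels 1, …, n - 1 together shift by c; ω is a 3-cycle of the nonzero
-- elements, so ω a ⊕ ω² a = a.
filler : Parity → Permutation′ 4 × Permutation′ 4
filler 0ℙ = ω , ω ∘ₚ ω
filler 1ℙ = id , id

filler-compensates : ∀ p a → ((proj₁ (filler p) ⟨$⟩ʳ a) ⊕ (proj₂ (filler p) ⟨$⟩ʳ a)) ⊕ p · a ≡ a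
filler-compensates 0ℙ = from-yes (all? λ a → ((ω ⟨$⟩ʳ a) ⊕ ((ω ∘ₚ ω) ⟨$⟩ʳ a)) ⊕ 0F ≟ a)
filler-compensates 1ℙ = from-yes (all? λ a → (a ⊕ a) ⊕ a ≟ a)

schedule : Permutation′ 4 → ℕ → ℕ → Permutation′ 4
schedule π r 0                   = π
schedule π r 1                   = proj₁ (filler (parity r))
schedule π r 2                   = proj₂ (filler (parity r))
schedule π r (suc (suc (suc _))) = id

product-schedule : ∀ π r a → product _⊕_ 0F (3 + r) (λ l → schedule π r l ⟨$⟩ʳ a) ≡ (π ⟨$⟩ʳ a) ⊕ a
product-schedule π r a = begin
  product _⊕_ 0F (3 + r) (λ l → schedule π r l ⟨$⟩ʳ a)
    ≡⟨ product-+ isMonoid 3 r _ ⟩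
  (((0F ⊕ πa) ⊕ f₁) ⊕ f₂) ⊕ product _⊕_ 0F r (λ _ → a)
    ≡⟨ cong₂ (λ u v → ((u ⊕ f₁) ⊕ f₂) ⊕ v) (⊕-identityˡ πa) (product-const r a) ⟩
  ((πa ⊕ f₁) ⊕ f₂) ⊕ parity r · a
    ≡⟨ cong (_⊕ parity r · a) (⊕-assoc πa f₁ f₂) ⟩
  (πa ⊕ (f₁ ⊕ f₂)) ⊕ parity r · a
    ≡⟨ ⊕-assoc πa (f₁ ⊕ f₂) (parity r · a) ⟩
  πa ⊕ ((f₁ ⊕ f₂) ⊕ parity r · a)
    ≡⟨ cong (πa ⊕_) (filler-compensates (parity r) a) ⟩
  πa ⊕ a
    ∎
  where
  open IsAbelianGroup ⊕-isAbelianGroup using (isMonoid)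
  πa f₁ f₂ : Fin 4
  πa = π ⟨$⟩ʳ a
  f₁ = proj₁ (filler (parity r)) ⟨$⟩ʳ a
  f₂ = proj₂ (filler (parity r)) ⟨$⟩ʳ a

SupportBelow : ℕ → Permutation′ 4 → Set
SupportBelow s π = ∀ c → (toℕ c < s → π ⟨$⟩ʳ c ≢ c) × (s ≤ toℕ c → π ⟨$⟩ʳ c ≡ c)

supportBelow? : ∀ s π → Dec (SupportBelow s π)
supportBelow? s π = all? λ c →
  ((toℕ c <? s) →-dec ¬? (π ⟨$⟩ʳ c ≟ c)) ×-dec ((s ≤? toℕ c) →-dec (π ⟨$⟩ʳ c ≟ c))

supportBelow : ∀ s → s ≡ 0 ⊎ s ≡ 2 ⊎ s ≡ 3 ⊎ s ≡ 4 → ∃ (SupportBelow s)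
supportBelow .0 (inj₁ refl)               = id , from-yes (supportBelow? 0 id)
supportBelow .2 (inj₂ (inj₁ refl))        = transpose 0F 1F , from-yes (supportBelow? 2 (transpose 0F 1F))
supportBelow .3 (inj₂ (inj₂ (inj₁ refl))) = π₃ , from-yes (supportBelow? 3 π₃)
  where
  π₃ : Permutation′ 4
  π₃ = transpose 0F 1F ∘ₚ transpose 1F 2F
supportBelow .4 (inj₂ (inj₂ (inj₂ refl))) = π₄ , from-yes (supportBelow? 4 π₄)
  where
  π₄ : Permutation′ 4
  π₄ = transpose 0F 1F ∘ₚ transpose 2F 3F

theorem6p9 : (n s : ℕ) → 3 ≤ n → (s ≡ 0 ⊎ s ≡ 2 ⊎ s ≡ 3 ⊎ s ≡ 4) →
    Σ ((u v : Vtx 4 n) → Arc 4 n u v → Fin 4) λ col →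
      (c : Fin 4) →
        (toℕ c < s → CycleFactor (Vtx 4 n) (ColourClass 4 n 4 col c) (2 * n))
        × (s ≤ toℕ c → CycleFactor (Vtx 4 n) (ColourClass 4 n 4 col c) n)
theorem6p9 (suc (suc (suc r))) s (s≤s (s≤s (s≤s z≤n))) s-allowed with supportBelow s s-allowed
... | π , π-support = colouring , λ c →
  (λ c<s → doubleLap-cycleFactor c (shift≢0 c c<s) (⊕-self (shift c))) ,
  (λ s≤c → lap-cycleFactor c (shift≡0 c s≤c))
  where
  open DifferenceColouring ⊕-isAbelianGroup (suc (suc r)) (schedule π r)

  shift≢0 : ∀ c → toℕ c < s → shift c ≢ 0F
  shift≢0 c c<s shift≡0 = proj₁ (π-support c) c<s
    (⊕≡0⇒≡ (π ⟨$⟩ʳ c) c (trans (sym (product-schedule π r c)) shift≡0))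

  shift≡0 : ∀ c → s ≤ toℕ c → shift c ≡ 0F
  shift≡0 c s≤c = trans (product-schedule π r c)
    (trans (cong (_⊕ c) (proj₂ (π-support c) s≤c)) (⊕-self c))
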